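{- Let $G(V,E)$ be an undirected graph satisfying the standing assumptions stated in the context, with node set $V=\{1,\dots,n\}$, arc set $E=\{a_1,\dots,a_m\}$, source $1$ and sink $n$. Let $P$ be the path from $1$ to $n$ output by the Earliest Path Algorithm (defined in the context), identified with its arc-incidence vector in $\{0,1\}^m$. Then $P$ is the earliest simple $1$–$n$ path in the BAT ordering, i.e., there is no simple path $X$ from $1$ to $n$ in $G$ (identified with its arc-incidence vector) with $X \ll P$.
   Context: Standing assumptions: $G(V,E)$ is an undirected graph with no parallel arcs and no self-loops, and all nodes are interconnected (the graph is connected). A set of arcs (in particular a path) is identified with the binary vector $X=(x_1,\dots,x_m)$ where $x_i=X(a_i)=1$ iff $a_i$ is in the set. BAT ordering: for $X,X^*\in\{0,1\}^m$, $X\ll X^*$ if there exists an index $i$ with $X(a_i)=0<X^*(a_i)=1$ and $X(a_j)=X^*(a_j)$ for all $j>i$. Earliest Path Algorithm: assign each arc $a_i$ the weight $W(a_i)=2^{i-1}$; run Dijkstra's algorithm from node $1$ with these weights (initialize $\mathrm{dist}[1]=0$, all other $\mathrm{dist}=\infty$, $\mathrm{prev}=\mathrm{NULL}$; repeatedly extract the unprocessed node $u$ of smallest $\mathrm{dist}$, stopping when $u=n$, and relax each arc $u$–$v$: if $\mathrm{dist}[u]+W<\mathrm{dist}[v]$, set $\mathrm{dist}[v]$ to that value and $\mathrm{prev}[v]=u$); then reconstruct the path by following $\mathrm{prev}$ from $n$ back to $1$. -}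

module Defs where

open import Data.Nat using (ℕ; zero; suc; _+_; _^_; _<ᵇ_)
open import Data.Fin using (Fin; toℕ; fromℕ) renaming (_≟_ to _≟ᶠ_)
import Data.Fin as F
open import Data.Bool using (Bool; true; false; if_then_else_; _∧_; _∨_; not)
open import Data.Maybe using (Maybe; just; nothing)
open import Data.List using (List; []; _∷_; foldl; reverse; tabulate)
open import Data.List.Relation.Unary.Any using (any?)
open import Data.Product using (_×_; _,_; proj₁; proj₂; Σ; ∃; ∃-syntax)
open import Data.Sum using (_⊎_)
open import Relation.Binary.PropositionalEquality using (_≡_; _≢_)
open import Relation.Nullary using (¬_; does)
open import Data.List.Relation.Unary.Unique.Propositional using (Unique)

-- Nodes are  Fin N  (node "1" of the paper is  zero, node "n"
-- is the last element  fromℕ k  when N = suc k).  Arcs are indexed by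
-- Fin m  (arc a_{i+1} of the paper is index i, 0-based); each arc is
-- given by its (unordered) pair of endpoints.

Arcs : ℕ → ℕ → Set
Arcs N m = Fin m → Fin N × Fin N

module _ {N m : ℕ} (arcs : Arcs N m) where

  Joins : Fin m → Fin N → Fin N → Set
  Joins i u v = (arcs i ≡ (u , v)) ⊎ (arcs i ≡ (v , u))

  data Walk : Fin N → Fin N → List (Fin N) → List (Fin m) → Set where
    here : ∀ {s} → Walk s s (s ∷ []) []
    step : ∀ {u v t ns es} (i : Fin m) → Joins i u v →
           Walk v t ns es → Walk u t (u ∷ ns) (i ∷ es)

  SimplePath : Fin N → Fin N → List (Fin m) → Set
  SimplePath s t es = ∃[ ns ] (Walk s t ns es × Unique ns)

  NoSelfLoops : Set
  NoSelfLoops = ∀ i → proj₁ (arcs i) ≢ proj₂ (arcs i)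

  NoParallelArcs : Set
  NoParallelArcs = ∀ i j u v → Joins i u v → Joins j u v → i ≡ j

  Connected : Set
  Connected = ∀ u v → ∃[ ns ] ∃[ es ] Walk u v ns es

incidence : {m : ℕ} → List (Fin m) → Fin m → Bool
incidence es i = does (any? (λ j → i ≟ᶠ j) es)

_≪_ : {m : ℕ} → (Fin m → Bool) → (Fin m → Bool) → Set
X ≪ Y = ∃[ i ] (X i ≡ false × Y i ≡ true × (∀ j → i F.< j → X j ≡ Y j))

-- Earliest Path Algorithm (Dijkstra with W(a_i) = 2^i, 0-based index)

-- distances in ℕ ∪ {∞}, with ∞ = nothing
_<∞_ : Maybe ℕ → Maybe ℕ → Bool
just a <∞ just b = a <ᵇ b
just _ <∞ nothing = true
nothing <∞ _ = false

record State (N : ℕ) : Set where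
  constructor st
  field
    dist      : Fin N → Maybe ℕ
    prev      : Fin N → Maybe (Fin N)
    processed : Fin N → Bool
open State public

upd : {N : ℕ} {A : Set} → (Fin N → A) → Fin N → A → Fin N → A
upd f v x w = if does (w ≟ᶠ v) then x else f w

module EPA {k m : ℕ} (arcs : Arcs (suc k) m) where

  N : ℕ
  N = suc k

  source sink : Fin N
  source = F.zero
  sink = fromℕ k

  W : Fin m → ℕ
  W i = 2 ^ toℕ i

  initial : State N
  initial = st (λ v → if does (v ≟ᶠ source) then just 0 else nothing)
               (λ _ → nothing) (λ _ → false)

  nodes : List (Fin N)
  nodes = tabulate (λ i → i)

  -- extract the unprocessed node of smallest dist (ties broken by
  -- smallest index); nothing if every node is processed
  select : State N → Maybe (Fin N)
  select s = foldl pick nothing nodes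
    where
      pick : Maybe (Fin N) → Fin N → Maybe (Fin N)
      pick best v with processed s v
      ... | true = best
      ... | false with best
      ...   | nothing = just v
      ...   | just b = if dist s v <∞ dist s b then just v else just b

  other : Fin m → Fin N → Maybe (Fin N)
  other i u with arcs i
  ... | (x , y) = if does (x ≟ᶠ u) then just y
                  else (if does (y ≟ᶠ u) then just x else nothing)

  relaxArc : Fin N → State N → Fin m → State N
  relaxArc u s i with other i u | dist s u
  ... | nothing | _ = s
  ... | just v | nothing = s
  ... | just v | just d =
        if just (d + W i) <∞ dist s v
        then st (upd (dist s) v (just (d + W i))) (upd (prev s) v (just u))
                (processed s)
        else s

  arcList : List (Fin m)
  arcList = tabulate (λ i → i)

  relaxAll : Fin N → State N → State N
  relaxAll u s = foldl (relaxArc u) s arcList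

  markProcessed : Fin N → State N → State N
  markProcessed u s = st (dist s) (prev s) (upd (processed s) u true)

  -- main loop, with fuel (N iterations suffice: each one processes a node)
  loop : ℕ → State N → State N
  loop zero s = s
  loop (suc f) s with select s
  ... | nothing = s
  ... | just u = if does (u ≟ᶠ sink) then s
                 else loop f (relaxAll u (markProcessed u s))

  final : State N
  final = loop N initial

  -- the arc joining u and v (first one found; unique as no parallel arcs)
  arcBetween : Fin N → Fin N → Maybe (Fin m)
  arcBetween u v = foldl f nothing arcList
    where
      f : Maybe (Fin m) → Fin m → Maybe (Fin m)
      f (just j) _ = just j
      f nothing i with arcs i
      ... | (x , y) = if (does (x ≟ᶠ u) ∧ does (y ≟ᶠ v))
                         ∨ (does (x ≟ᶠ v) ∧ does (y ≟ᶠ u))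
                      then just i else nothing

  trace : ℕ → Fin N → List (Fin m)
  trace zero v = []
  trace (suc f) v with does (v ≟ᶠ source) | prev final v
  ... | true | _ = []
  ... | false | nothing = []
  ... | false | just u with arcBetween u v
  ...   | nothing = trace f u
  ...   | just i = i ∷ trace f u

  outputArcs : List (Fin m)
  outputArcs = reverse (trace N sink)

  outputP : Fin m → Bool
  outputP = incidence outputArcs

-- Give arc a_i the weight 2^(i-1). Since these are distinct powers of two, the weight of a
-- set of arcs is the number whose binary digits are its incidence vector, so X ≪ X* holds
-- exactly when X is lighter than X*: an earliest simple path is a lightest one. Dijkstra's
-- algorithm with these weights keeps the usual invariants (every processed node is no farther
-- than any unprocessed one, arcs out of processed nodes are relaxed, and each finite tentative
-- distance is realised through `prev` by a processed parent), so when the sink is extracted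
-- its distance is at most the weight of every walk, and following `prev` back from the sink
-- traces a simple path of exactly that weight.
module Submission where

open import Defs
open import Data.Nat using (ℕ; zero; suc; _+_; _*_; _^_; _≤_; _<_; _≤?_; z≤n; s≤s)
open import Data.Nat.Properties
open import Data.Nat.ListAction using (sum)
open import Data.Nat.ListAction.Properties using (sum-++)
open import Data.Nat.Tactic.RingSolver using (solve-∀)
open import Data.Fin using (Fin; toℕ) renaming (_≟_ to _≟ᶠ_)
import Data.Fin as F
open import Data.Fin.Properties using (pigeonhole)
open import Data.Bool using (Bool; true; false; _∨_; T)
open import Data.Maybe using (Maybe; just; nothing)
open import Data.Maybe.Properties using (just-injective)
open import Data.List using (List; []; _∷_; foldl; _++_; _∷ʳ_; map; reverse; length; lookup)
open import Data.List.Properties using (++-assoc; ++-identityʳ; map-++; unfold-reverse; length-++)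
open import Data.List.Relation.Unary.All using (All; []; _∷_)
import Data.List.Relation.Unary.All as All
open import Data.List.Relation.Unary.All.Properties using (All¬⇒¬Any; ¬Any⇒All¬; ∷ʳ⁺)
open import Data.List.Relation.Unary.Any using (here; there)
open import Data.List.Membership.Propositional using (_∈_)
open import Data.List.Membership.Propositional.Properties using (∈-lookup; ∈-tabulate⁺)
open import Data.List.Relation.Unary.Unique.Propositional using (Unique; []; _∷_)
import Data.List.Relation.Unary.Unique.Propositional.Properties as Unique
open import Data.Product using (_×_; _,_; proj₁; proj₂; ∃-syntax)
open import Data.Sum using (_⊎_; inj₁; inj₂)
import Data.Sum
open import Data.Empty using (⊥; ⊥-elim)
open import Function using (_∘_; case_of_)
open import Relation.Binary.PropositionalEquality
open import Relation.Nullary using (¬_; yes; no; does)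
open import Relation.Nullary.Decidable using (dec-true; dec-false)
open import Relation.Binary.Construct.Add.Supremum.NonStrict _≤_

≤⁺-refl : ∀ {a} → a ≤⁺ a
≤⁺-refl = ≤⁺-reflexive-≡ ≤-reflexive refl

<∞⇒≤⁺ : ∀ a b → (a <∞ b) ≡ true → a ≤⁺ b
<∞⇒≤⁺ (just a) (just b) a<b = [ <⇒≤ (<ᵇ⇒< a b (subst T (sym a<b) _)) ]
<∞⇒≤⁺ (just a) nothing  _   = _ ≤⊤⁺

<∞⇒≱⁺ : ∀ a b → (a <∞ b) ≡ true → ¬ (b ≤⁺ a)
<∞⇒≱⁺ (just a) (just b) a<b [ b≤a ] = <⇒≱ (<ᵇ⇒< a b (subst T (sym a<b) _)) b≤a

≮∞⇒≥⁺ : ∀ a b → (a <∞ b) ≡ false → b ≤⁺ a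
≮∞⇒≥⁺ (just a) (just b) a≮b = [ ≮⇒≥ (λ a<b → subst T a≮b (<⇒<ᵇ a<b)) ]
≮∞⇒≥⁺ nothing  b        _   = b ≤⊤⁺

infixl 6 _+∞_
_+∞_ : Maybe ℕ → ℕ → Maybe ℕ
just a  +∞ w = just (a + w)
nothing +∞ w = nothing

+∞-assoc : ∀ a b c → a +∞ b +∞ c ≡ a +∞ (b + c)
+∞-assoc (just a) b c = cong just (+-assoc a b c)
+∞-assoc nothing  b c = refl

≤⁺-+∞ : ∀ {a b c} w → a ≤⁺ just c → b ≤⁺ a +∞ w → b ≤⁺ just (c + w)
≤⁺-+∞ w [ a≤c ] b≤a+w = ≤⁺-trans ≤-trans b≤a+w [ +-monoˡ-≤ w a≤c ]

bit : Bool → ℕ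
bit false = 0
bit true  = 1

bit≤1 : ∀ b → bit b ≤ 1
bit≤1 false = z≤n
bit≤1 true  = ≤-refl

value : ∀ {m} → (Fin m → Bool) → ℕ
value {zero}  X = 0
value {suc m} X = bit (X F.zero) + 2 * value (X ∘ F.suc)

weight : ∀ {m} → List (Fin m) → ℕ
weight es = sum (map (λ i → 2 ^ toℕ i) es)

weight-∷ʳ : ∀ {m} (es : List (Fin m)) i → weight (es ∷ʳ i) ≡ weight es + 2 ^ toℕ i
weight-∷ʳ es i = begin
  weight (es ∷ʳ i)                  ≡⟨ cong sum (map-++ pow2 es (i ∷ [])) ⟩
  sum (map pow2 es ++ pow2 i ∷ [])  ≡⟨ sum-++ (map pow2 es) (pow2 i ∷ []) ⟩
  weight es + (pow2 i + 0)          ≡⟨ cong (weight es +_) (+-identityʳ (pow2 i)) ⟩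
  weight es + pow2 i                ∎
  where
  open ≡-Reasoning
  pow2 : Fin _ → ℕ
  pow2 i = 2 ^ toℕ i

value-cong : ∀ {m} {X Y : Fin m → Bool} → (∀ j → X j ≡ Y j) → value X ≡ value Y
value-cong {zero}  X≗Y = refl
value-cong {suc m} X≗Y = cong₂ (λ b v → bit b + 2 * v) (X≗Y F.zero) (value-cong (X≗Y ∘ F.suc))

≪⇒value< : ∀ {m} {X Y : Fin m → Bool} → X ≪ Y → value X < value Y
≪⇒value< {suc m} {X} {Y} (F.zero , X₀ , Y₀ , agree)
  rewrite X₀ | Y₀ | value-cong {X = X ∘ F.suc} {Y ∘ F.suc} (λ j → agree (F.suc j) (s≤s z≤n)) = ≤-refl
≪⇒value< {suc m} {X} {Y} (F.suc i , Xi , Yi , agree) = begin-strict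
  bit (X F.zero) + 2 * value (X ∘ F.suc) ≤⟨ +-monoˡ-≤ _ (bit≤1 (X F.zero)) ⟩
  1 + 2 * value (X ∘ F.suc)              <⟨ n<1+n _ ⟩
  2 + 2 * value (X ∘ F.suc)              ≡⟨ *-suc 2 _ ⟨
  2 * suc (value (X ∘ F.suc))            ≤⟨ *-monoʳ-≤ 2 tail< ⟩
  2 * value (Y ∘ F.suc)                  ≤⟨ m≤n+m _ (bit (Y F.zero)) ⟩
  bit (Y F.zero) + 2 * value (Y ∘ F.suc) ∎
  where
  open ≤-Reasoning
  tail< : value (X ∘ F.suc) < value (Y ∘ F.suc)
  tail< = ≪⇒value< (i , Xi , Yi , λ j i<j → agree (F.suc j) (s≤s i<j))

value-insert : ∀ {m} (X : Fin m → Bool) i → X i ≡ false →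
               value (λ j → does (j ≟ᶠ i) ∨ X j) ≡ 2 ^ toℕ i + value X
value-insert {suc m} X F.zero Xi rewrite Xi = refl
value-insert {suc m} X (F.suc i) Xi = begin
  bit (X F.zero) + 2 * value (λ j → does (j ≟ᶠ i) ∨ X (F.suc j))
    ≡⟨ cong (λ v → bit (X F.zero) + 2 * v) (value-insert (X ∘ F.suc) i Xi) ⟩
  bit (X F.zero) + 2 * (2 ^ toℕ i + value (X ∘ F.suc))
    ≡⟨ rearrange (bit (X F.zero)) (2 ^ toℕ i) _ ⟩
  2 * 2 ^ toℕ i + (bit (X F.zero) + 2 * value (X ∘ F.suc))
    ∎
  where
  open ≡-Reasoning
  rearrange : ∀ b p v → b + 2 * (p + v) ≡ 2 * p + (b + 2 * v)
  rearrange = solve-∀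

value-incidence : ∀ {m} {es : List (Fin m)} → Unique es → value (incidence es) ≡ weight es
value-incidence {m} {[]} [] = value-empty m
  where
  value-empty : ∀ m → value {m} (λ _ → false) ≡ 0
  value-empty zero    = refl
  value-empty (suc m) = cong (2 *_) (value-empty m)
value-incidence {es = i ∷ es} (i∉es ∷ u) = begin
  value (incidence (i ∷ es))     ≡⟨ value-insert (incidence es) i (incidence-∉ i∉es) ⟩
  2 ^ toℕ i + value (incidence es) ≡⟨ cong (2 ^ toℕ i +_) (value-incidence u) ⟩
  2 ^ toℕ i + weight es          ∎
  where
  open ≡-Reasoning
  incidence-∉ : ∀ {j js} → All (j ≢_) js → incidence js j ≡ false
  incidence-∉ []           = refl
  incidence-∉ (j≢k ∷ j∉js) rewrite dec-false (_ ≟ᶠ _) j≢k = incidence-∉ j∉js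

count : ∀ {n} → (Fin n → Bool) → ℕ
count {zero}  p = 0
count {suc n} p = bit (p F.zero) + count (p ∘ F.suc)

count-const-false : ∀ n → count {n} (λ _ → false) ≡ 0
count-const-false zero    = refl
count-const-false (suc n) = count-const-false n

count≤n : ∀ {n} (p : Fin n → Bool) → count p ≤ n
count≤n {zero}  p = z≤n
count≤n {suc n} p = +-mono-≤ (bit≤1 (p F.zero)) (count≤n (p ∘ F.suc))

count<n : ∀ {n} (p : Fin n → Bool) {i} → p i ≡ false → count p < n
count<n {suc n} p {F.zero}  pᵢ rewrite pᵢ = s≤s (count≤n (p ∘ F.suc))
count<n {suc n} p {F.suc i} pᵢ = +-mono-≤-< (bit≤1 (p F.zero)) (count<n (p ∘ F.suc) pᵢ)

count-upd : ∀ {n} (p : Fin n → Bool) {i} → p i ≡ false → count (upd p i true) ≡ suc (count p)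
count-upd {suc n} p {F.zero}  pᵢ rewrite pᵢ = refl
count-upd {suc n} p {F.suc i} pᵢ =
  trans (cong (bit (p F.zero) +_) (count-upd (p ∘ F.suc) pᵢ)) (+-suc _ _)

Unique⇒length≤ : ∀ {n} {xs : List (Fin n)} → Unique xs → length xs ≤ n
Unique⇒length≤ {n} {xs} u with length xs ≤? n
... | yes ≤n = ≤n
... | no  ≰n with pigeonhole (≰⇒> ≰n) (lookup xs)
...   | i , j , i<j , xsᵢ≡xsⱼ = ⊥-elim (lookup-distinct u i<j xsᵢ≡xsⱼ)
  where
  lookup-distinct : ∀ {ys : List (Fin n)} → Unique ys → ∀ {i j} → i F.< j → lookup ys i ≢ lookup ys j
  lookup-distinct (y∉ys ∷ _) {F.zero}  {F.suc j} _         = All.lookup y∉ys (∈-lookup j)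
  lookup-distinct (_ ∷ u)    {F.suc i} {F.suc j} (s≤s i<j) = lookup-distinct u i<j

foldl-invariant : ∀ {A B : Set} {f : B → A → B} (P : List A → B → Set) →
                  (∀ {xs b} x → P xs b → P (xs ∷ʳ x) (f b x)) →
                  ∀ {xs b} ys → P xs b → P (xs ++ ys) (foldl f b ys)
foldl-invariant P preserve {xs} []       Pxs = subst (λ zs → P zs _) (sym (++-identityʳ xs)) Pxs
foldl-invariant P preserve {xs} (y ∷ ys) Pxs =
  subst (λ zs → P zs _) (++-assoc xs (y ∷ []) ys) (foldl-invariant P preserve ys (preserve y Pxs))

module _ {N m : ℕ} (arcs : Arcs N m) where

  walk-∷ʳ : ∀ {s u v ns es} i → Walk arcs s u ns es → Joins arcs i u v →
            Walk arcs s v (ns ∷ʳ v) (es ∷ʳ i)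
  walk-∷ʳ i here           i∶uv = step i i∶uv here
  walk-∷ʳ i (step j j∶ w) i∶uv = step j j∶ (walk-∷ʳ i w i∶uv)

  Joins-endpoint : ∀ {i u v a b} → Joins arcs i u v → Joins arcs i a b → u ≡ a ⊎ u ≡ b
  Joins-endpoint (inj₁ p) (inj₁ q) = inj₁ (cong proj₁ (trans (sym p) q))
  Joins-endpoint (inj₁ p) (inj₂ q) = inj₂ (cong proj₁ (trans (sym p) q))
  Joins-endpoint (inj₂ p) (inj₁ q) = inj₂ (cong proj₂ (trans (sym p) q))
  Joins-endpoint (inj₂ p) (inj₂ q) = inj₁ (cong proj₂ (trans (sym p) q))

  walk-arc-endpoints : ∀ {s t ns es i} → Walk arcs s t ns es → i ∈ es →
                       ∃[ a ] ∃[ b ] (Joins arcs i a b × a ∈ ns × b ∈ ns)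
  walk-arc-endpoints (step {u} {v} i i∶uv w) (here refl) = u , v , i∶uv , here refl , there (start∈ w)
    where
    start∈ : ∀ {s t ns es} → Walk arcs s t ns es → s ∈ ns
    start∈ here         = here refl
    start∈ (step _ _ _) = here refl
  walk-arc-endpoints (step i i∶uv w) (there i∈es) with walk-arc-endpoints w i∈es
  ... | a , b , i∶ab , a∈ , b∈ = a , b , i∶ab , there a∈ , there b∈

  -- If the first arc recurred, its endpoint u would recur among the later nodes.
  simple-walk-arcs-unique : ∀ {s t ns es} → Walk arcs s t ns es → Unique ns → Unique es
  simple-walk-arcs-unique here               _            = []
  simple-walk-arcs-unique (step {u} i i∶uv w) (u∉ns ∷ uns) =
    ¬Any⇒All¬ _ i∉es ∷ simple-walk-arcs-unique w uns
    where
    i∉es : ¬ (i ∈ _)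
    i∉es i∈es with walk-arc-endpoints w i∈es
    ... | a , b , i∶ab , a∈ , b∈ with Joins-endpoint i∶uv i∶ab
    ...   | inj₁ refl = All¬⇒¬Any u∉ns a∈
    ...   | inj₂ refl = All¬⇒¬Any u∉ns b∈

-- `select` and `arcBetween` fold functions defined in `where` clauses, which
-- cannot be named from outside; unifying with `refl` recovers them.
record FoldlOf {A B : Set} (b : B) (xs : List A) (r : B) : Set where
  field
    operator : B → A → B
    unfolds  : foldl operator b xs ≡ r

≡true⇒≢false : ∀ {b} → b ≡ true → b ≢ false
≡true⇒≢false refl ()

module Dijkstra (k m : ℕ) (arcs : Arcs (suc k) m) where
  open EPA arcs

  ∈-nodes : ∀ v → v ∈ nodes
  ∈-nodes = ∈-tabulate⁺

  ∈-arcList : ∀ i → i ∈ arcList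
  ∈-arcList = ∈-tabulate⁺

  upd-≡ : ∀ {A : Set} (f : Fin N → A) v x → upd f v x v ≡ x
  upd-≡ f v x rewrite dec-true (v ≟ᶠ v) refl = refl

  upd-≢ : ∀ {A : Set} (f : Fin N → A) v x {w} → w ≢ v → upd f v x w ≡ f w
  upd-≢ f v x {w} w≢v rewrite dec-false (w ≟ᶠ v) w≢v = refl

  other-Joins : ∀ i u {v} → other i u ≡ just v → Joins arcs i u v
  other-Joins i u eq with arcs i
  ... | x , y with x ≟ᶠ u
  ...   | yes refl = inj₁ (cong (x ,_) (just-injective eq))
  ...   | no _ with y ≟ᶠ u
  ...     | yes refl = inj₂ (cong (_, y) (just-injective eq))
  ...     | no _ with () ← eq

  Joins-other : ∀ {i u v} → Joins arcs i u v → other i u ≡ just v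
  Joins-other {u = u} (inj₁ i∶uv) rewrite i∶uv | dec-true (u ≟ᶠ u) refl = refl
  Joins-other {u = u} {v} (inj₂ i∶vu) rewrite i∶vu with v ≟ᶠ u
  ... | yes refl = refl
  ... | no _ rewrite dec-true (u ≟ᶠ u) refl = refl

  MinimalAmong : State N → List (Fin N) → Maybe (Fin N) → Set
  MinimalAmong s vs nothing  = All (λ v → processed s v ≡ true) vs
  MinimalAmong s vs (just u) =
    processed s u ≡ false × All (λ v → processed s v ≡ false → dist s u ≤⁺ dist s v) vs

  select-minimal : ∀ s → MinimalAmong s nodes (select s)
  select-minimal s =
    subst (MinimalAmong s nodes) unfolds (foldl-invariant (MinimalAmong s) pick-minimal nodes [])
    where
    selectFold : FoldlOf nothing nodes (select s)
    selectFold = record { unfolds = refl }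
    open FoldlOf selectFold
    pick-minimal : ∀ {vs b} v → MinimalAmong s vs b → MinimalAmong s (vs ∷ʳ v) (operator b v)
    pick-minimal {b = b} v min with processed s v in pᵥ
    pick-minimal {b = nothing} v min | true = ∷ʳ⁺ min pᵥ
    pick-minimal {b = just u}  v (pᵤ , min) | true = pᵤ , ∷ʳ⁺ min (⊥-elim ∘ ≡true⇒≢false pᵥ)
    pick-minimal {b = nothing} v min | false =
      pᵥ , ∷ʳ⁺ (All.map (λ p → ⊥-elim ∘ ≡true⇒≢false p) min) (λ _ → ≤⁺-refl)
    pick-minimal {b = just u}  v (pᵤ , min) | false with dist s v <∞ dist s u in v<u
    ... | true  = pᵥ , ∷ʳ⁺ (All.map (λ u≤ p → ≤⁺-trans ≤-trans (<∞⇒≤⁺ _ _ v<u) (u≤ p)) min)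
                           (λ _ → ≤⁺-refl)
    ... | false = pᵤ , ∷ʳ⁺ min (λ _ → ≮∞⇒≥⁺ _ _ v<u)

  Relaxed : State N → Fin N → Fin m → Set
  Relaxed s w i = ∀ {x} → Joins arcs i w x → dist s x ≤⁺ dist s w +∞ W i

  AllRelaxed : State N → Set
  AllRelaxed s = ∀ w i → processed s w ≡ true → Relaxed s w i

  record Parent (s : State N) (v : Fin N) (d : ℕ) : Set where
    constructor parent
    field
      node         : Fin N
      arc          : Fin m
      node-dist    : ℕ
      prev≡node    : prev s v ≡ just node
      node-processed : processed s node ≡ true
      arc-joins    : Joins arcs arc node v
      dist≡node-dist : dist s node ≡ just node-dist
      d≡           : d ≡ node-dist + W arc

  record Invariant (s : State N) : Set where
    field
      sink-unprocessed : processed s sink ≡ false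
      source-dist      : dist s source ≡ just 0
      parents          : ∀ {v d} → v ≢ source → dist s v ≡ just d → Parent s v d
      processed-first  : ∀ {w v} → processed s w ≡ true → processed s v ≡ false →
                         dist s w ≤⁺ dist s v

  record Relaxing (u : Fin N) (s : State N) (is : List (Fin m)) : Set where
    field
      invariant      : Invariant s
      u-processed    : processed s u ≡ true
      u-farthest     : ∀ {w} → processed s w ≡ true → dist s w ≤⁺ dist s u
      others-relaxed : ∀ {w} i → processed s w ≡ true → w ≢ u → Relaxed s w i
      done-relaxed   : All (Relaxed s u) is

  relaxing-∷ʳ : ∀ {u s is} i → Relaxing u s is → Relaxed s u i → Relaxing u s (is ∷ʳ i)
  relaxing-∷ʳ i R relaxed = record
    { invariant = invariant ; u-processed = u-processed ; u-farthest = u-farthest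
    ; others-relaxed = others-relaxed ; done-relaxed = ∷ʳ⁺ done-relaxed relaxed }
    where open Relaxing R

  -- The improved distance d + W i exceeds dist u, which bounds every processed node, so the
  -- node v whose distance drops is unprocessed and is neither u nor the source.
  module Improve {u v i d s is} (R : Relaxing u s is) (other≡v : other i u ≡ just v)
                 (dist≡d : dist s u ≡ just d) (closer : (just (d + W i) <∞ dist s v) ≡ true) where
    open Relaxing R
    open Invariant invariant

    e : ℕ
    e = d + W i

    s′ : State N
    s′ = st (upd (dist s) v (just e)) (upd (prev s) v (just u)) (processed s)

    not-v : ∀ {w} → dist s w ≤⁺ just d → w ≢ v
    not-v w≤d refl = <∞⇒≱⁺ _ _ closer (≤⁺-trans ≤-trans w≤d [ m≤m+n d (W i) ])

    processed≤d : ∀ {w} → processed s w ≡ true → dist s w ≤⁺ just d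
    processed≤d {w} pw = subst (dist s w ≤⁺_) dist≡d (u-farthest pw)

    processed≢v : ∀ {w} → processed s w ≡ true → w ≢ v
    processed≢v pw = not-v (processed≤d pw)

    dist-kept : ∀ {w} → w ≢ v → dist s′ w ≡ dist s w
    dist-kept = upd-≢ (dist s) v (just e)

    dist-decreases : ∀ x → dist s′ x ≤⁺ dist s x
    dist-decreases x with x ≟ᶠ v
    ... | yes refl = <∞⇒≤⁺ _ _ closer
    ... | no  _    = ≤⁺-refl

    relaxed-kept : ∀ {w} j → w ≢ v → Relaxed s w j → Relaxed s′ w j
    relaxed-kept {w} j w≢v relaxed {x} j∶wx rewrite dist-kept w≢v =
      ≤⁺-trans ≤-trans (dist-decreases x) (relaxed j∶wx)

    u≢v : u ≢ v
    u≢v = processed≢v u-processed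

    source≢v : source ≢ v
    source≢v = not-v (subst (_≤⁺ just d) (sym source-dist) [ z≤n ])

    relaxed-i : Relaxed s′ u i
    relaxed-i j∶ux with just-injective (trans (sym (Joins-other j∶ux)) other≡v)
    ... | refl rewrite upd-≡ (dist s) v (just e) | dist-kept u≢v | dist≡d = ≤⁺-refl

    parents′ : ∀ {y d′} → y ≢ source → dist s′ y ≡ just d′ → Parent s′ y d′
    parents′ {y} y≢src dist≡d′ with y ≟ᶠ v
    ... | yes refl = parent u i d (upd-≡ (prev s) v (just u)) u-processed (other-Joins i u other≡v)
                       (trans (dist-kept u≢v) dist≡d) (sym (just-injective dist≡d′))
    ... | no  y≢v  with parents y≢src dist≡d′
    ...   | parent w j dw prev≡w pw j∶wy dist≡dw d′≡ =
              parent w j dw (trans (upd-≢ (prev s) v (just u) y≢v) prev≡w) pw j∶wy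
                (trans (dist-kept (processed≢v pw)) dist≡dw) d′≡

    processed-first′ : ∀ {w y} → processed s w ≡ true → processed s y ≡ false →
                       dist s′ w ≤⁺ dist s′ y
    processed-first′ {w} {y} pw py rewrite dist-kept (processed≢v pw) with y ≟ᶠ v
    ... | yes refl = ≤⁺-trans ≤-trans (processed≤d pw) [ m≤m+n d (W i) ]
    ... | no  _    = processed-first pw py

    relaxing : Relaxing u s′ (is ∷ʳ i)
    relaxing = record
      { invariant      = record
        { sink-unprocessed = sink-unprocessed
        ; source-dist      = trans (dist-kept source≢v) source-dist
        ; parents          = parents′
        ; processed-first  = processed-first′
        }
      ; u-processed    = u-processed
      ; u-farthest     = λ pw →
          subst₂ _≤⁺_ (sym (dist-kept (processed≢v pw))) (sym (dist-kept u≢v)) (u-farthest pw)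
      ; others-relaxed = λ j pw w≢u → relaxed-kept j (processed≢v pw) (others-relaxed j pw w≢u)
      ; done-relaxed   = ∷ʳ⁺ (All.map (relaxed-kept _ u≢v) done-relaxed) relaxed-i
      }

  relaxArc-relaxing : ∀ {u s is} i → Relaxing u s is → Relaxing u (relaxArc u s i) (is ∷ʳ i)
  relaxArc-relaxing {u} {s} i R with other i u in other≡ | dist s u in dist≡
  ... | nothing | _       =
          relaxing-∷ʳ {s = s} i R (λ i∶ux → case trans (sym other≡) (Joins-other i∶ux) of λ ())
  ... | just v  | nothing =
          relaxing-∷ʳ {s = s} i R (λ {x} _ → subst (λ du → dist s x ≤⁺ du +∞ W i) (sym dist≡) (_ ≤⊤⁺))
  ... | just v  | just d with just (d + W i) <∞ dist s v in closer
  ...   | true  = Improve.relaxing R other≡ dist≡ closer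
  ...   | false = relaxing-∷ʳ {s = s} i R relaxed
    where
    relaxed : Relaxed s u i
    relaxed i∶ux with just-injective (trans (sym other≡) (Joins-other i∶ux))
    ... | refl rewrite dist≡ = ≮∞⇒≥⁺ _ _ closer

  processed-relaxArc : ∀ u s i → processed (relaxArc u s i) ≡ processed s
  processed-relaxArc u s i with other i u | dist s u
  ... | nothing | _       = refl
  ... | just v  | nothing = refl
  ... | just v  | just d with just (d + W i) <∞ dist s v
  ...   | true  = refl
  ...   | false = refl

  processed-relaxAll : ∀ u s → processed (relaxAll u s) ≡ processed s
  processed-relaxAll u = go arcList
    where
    go : ∀ is s → processed (foldl (relaxArc u) s is) ≡ processed s
    go []       s = refl
    go (i ∷ is) s = trans (go is (relaxArc u s i)) (processed-relaxArc u s i)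

  markProcessed-relaxing : ∀ {s u} → Invariant s → AllRelaxed s → MinimalAmong s nodes (just u) →
                           u ≢ sink → Relaxing u (markProcessed u s) []
  markProcessed-relaxing {s} {u} inv relaxed (pᵤ , u-minimal) u≢sink = record
    { invariant      = record
      { sink-unprocessed = trans (upd-≢ (processed s) u true (u≢sink ∘ sym)) sink-unprocessed
      ; source-dist      = source-dist
      ; parents          = parents′
      ; processed-first  = processed-first′
      }
    ; u-processed    = upd-≡ (processed s) u true
    ; u-farthest     = u-farthest
    ; others-relaxed = λ i pw w≢u → relaxed _ i (trans (sym (upd-≢ (processed s) u true w≢u)) pw)
    ; done-relaxed   = []
    }
    where
    open Invariant inv
    processed′ : Fin N → Bool
    processed′ = upd (processed s) u true
    u≤ : ∀ {v} → processed s v ≡ false → dist s u ≤⁺ dist s v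
    u≤ pᵥ = All.lookup u-minimal (∈-nodes _) pᵥ
    parents′ : ∀ {v d} → v ≢ source → dist s v ≡ just d → Parent (markProcessed u s) v d
    parents′ v≢src dist≡d with parents v≢src dist≡d
    ... | parent w j dw prev≡w pw j∶wv dist≡dw d≡ =
            parent w j dw prev≡w (still-processed pw) j∶wv dist≡dw d≡
      where
      still-processed : ∀ {w} → processed s w ≡ true → processed′ w ≡ true
      still-processed {w} pw with w ≟ᶠ u
      ... | yes _ = refl
      ... | no  _ = pw
    processed-first′ : ∀ {w v} → processed′ w ≡ true → processed′ v ≡ false →
                       dist s w ≤⁺ dist s v
    processed-first′ {w} {v} pw pv with v ≟ᶠ u | w ≟ᶠ u
    ... | yes refl | _        = ⊥-elim (≡true⇒≢false refl pv)
    ... | no  _    | yes refl = u≤ pv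
    ... | no  _    | no  _    = processed-first pw pv
    u-farthest : ∀ {w} → processed′ w ≡ true → dist s w ≤⁺ dist s u
    u-farthest {w} pw with w ≟ᶠ u
    ... | yes refl = ≤⁺-refl
    ... | no  _    = processed-first pw pᵤ

  Sound : State N → Set
  Sound s = Invariant s × AllRelaxed s

  relaxAll-sound : ∀ {u s} → Relaxing u s [] → Sound (relaxAll u s)
  relaxAll-sound {u} {s} R = invariant , relaxed
    where
    R′ : Relaxing u (relaxAll u s) arcList
    R′ = foldl-invariant (λ is s′ → Relaxing u s′ is) relaxArc-relaxing arcList R
    open Relaxing R′
    relaxed : AllRelaxed (relaxAll u s)
    relaxed w i pw with w ≟ᶠ u
    ... | yes refl = All.lookup done-relaxed (∈-arcList i)
    ... | no  w≢u  = others-relaxed i pw w≢u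

  initial-sound : Sound initial
  initial-sound = record
    { sink-unprocessed = refl
    ; source-dist      = refl
    ; parents          = λ { {F.zero} src≢src _ → ⊥-elim (src≢src refl) ; {F.suc v} _ () }
    ; processed-first  = λ ()
    } , λ _ _ ()

  -- Fuel suffices: every round processes a new node, and the sink is never processed.
  loop-sound : ∀ f s → Sound s → N ≤ count (processed s) + f →
               Sound (loop f s) × select (loop f s) ≡ just sink
  loop-sound zero s (inv , _) enough =
    ⊥-elim (<⇒≱ (count<n (processed s) sink-unprocessed) (subst (N ≤_) (+-identityʳ _) enough))
    where open Invariant inv
  loop-sound (suc f) s (inv , relaxed) enough with select s in select≡ | select-minimal s
  ... | nothing | all-processed =
          ⊥-elim (≡true⇒≢false (All.lookup all-processed (∈-nodes sink)) sink-unprocessed)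
    where open Invariant inv
  ... | just u | minimal with u ≟ᶠ sink
  ...   | yes refl = (inv , relaxed) , select≡
  ...   | no u≢sink =
            loop-sound f _ (relaxAll-sound (markProcessed-relaxing inv relaxed minimal u≢sink)) enough′
    where
    enough′ : N ≤ count (processed (relaxAll u (markProcessed u s))) + f
    enough′ rewrite processed-relaxAll u (markProcessed u s) | count-upd (processed s) (proj₁ minimal) =
      subst (N ≤_) (+-suc _ f) enough

  final-sound : Sound final × select final ≡ just sink
  final-sound =
    loop-sound N initial initial-sound (subst (N ≤_) (cong (_+ N) (sym (count-const-false N))) ≤-refl)

  open Invariant (proj₁ (proj₁ final-sound))

  final-relaxed : AllRelaxed final
  final-relaxed = proj₂ (proj₁ final-sound)

  sink-minimal : ∀ {y} → processed final y ≡ false → dist final sink ≤⁺ dist final y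
  sink-minimal {y} = All.lookup (proj₂ sink-selected) (∈-nodes y)
    where
    sink-selected : MinimalAmong final nodes (just sink)
    sink-selected = subst (MinimalAmong final nodes) (proj₂ final-sound) (select-minimal final)

  data WithinBudget (s : State N) (a : Fin N) (c : ℕ) : Set where
    processed-within : processed s a ≡ true → dist s a ≤⁺ just c → WithinBudget s a c
    unprocessed-met  : ∀ y → processed s y ≡ false → dist s y ≤⁺ just c → WithinBudget s a c

  budget-step : ∀ {s a v c} i → AllRelaxed s → Joins arcs i a v →
                WithinBudget s a c → WithinBudget s v (c + W i)
  budget-step {s} {v = v} i relaxed i∶av (processed-within pₐ a≤c) with processed s v in pᵥ
  ... | true  = processed-within pᵥ (≤⁺-+∞ (W i) a≤c (relaxed _ i pₐ i∶av))
  ... | false = unprocessed-met v pᵥ (≤⁺-+∞ (W i) a≤c (relaxed _ i pₐ i∶av))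
  budget-step {c = c} i _ _ (unprocessed-met y p_y y≤c) =
    unprocessed-met y p_y (≤⁺-trans ≤-trans y≤c [ m≤m+n c (W i) ])

  budget-walk : ∀ {s a z ns es} c → AllRelaxed s → WithinBudget s a c → Walk arcs a z ns es →
                WithinBudget s z (c + weight es)
  budget-walk {s} {z = z} c _ within here = subst (WithinBudget s z) (sym (+-identityʳ c)) within
  budget-walk {s} {z = z} c relaxed within (step {es = es} i i∶av w) =
    subst (WithinBudget s z) (+-assoc c (W i) (weight es))
      (budget-walk (c + W i) relaxed (budget-step i relaxed i∶av within) w)

  dist-sink≤weight : ∀ {ns es} → Walk arcs source sink ns es → dist final sink ≤⁺ just (weight es)
  dist-sink≤weight w with budget-walk 0 final-relaxed start w
    where
    source≤0 : dist final source ≤⁺ just 0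
    source≤0 = subst (_≤⁺ just 0) (sym source-dist) ≤⁺-refl
    start : WithinBudget final source 0
    start with processed final source in pₛ
    ... | true  = processed-within pₛ source≤0
    ... | false = unprocessed-met source pₛ source≤0
  ... | processed-within p-sink _ = ⊥-elim (≡true⇒≢false p-sink sink-unprocessed)
  ... | unprocessed-met y p_y y≤  = ≤⁺-trans ≤-trans (sink-minimal p_y) y≤

  FoundArc : Fin N → Fin N → List (Fin m) → Maybe (Fin m) → Set
  FoundArc u v is nothing  = All (λ i → ¬ Joins arcs i u v) is
  FoundArc u v is (just j) = Joins arcs j u v

  arcBetween-found : ∀ u v → FoundArc u v arcList (arcBetween u v)
  arcBetween-found u v =
    subst (FoundArc u v arcList) unfolds (foldl-invariant (FoundArc u v) find arcList [])
    where
    arcBetweenFold : FoldlOf nothing arcList (arcBetween u v)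
    arcBetweenFold = record { unfolds = refl }
    open FoldlOf arcBetweenFold
    mismatch-refl : ∀ {a b : Fin N} → a ≢ a ⊎ b ≢ b → ⊥
    mismatch-refl (inj₁ a≢a) = a≢a refl
    mismatch-refl (inj₂ b≢b) = b≢b refl
    not-joins : ∀ {i x y} → arcs i ≡ (x , y) → x ≢ u ⊎ y ≢ v → x ≢ v ⊎ y ≢ u →
                ¬ Joins arcs i u v
    not-joins arcsᵢ uv-mismatch vu-mismatch (inj₁ i∶uv) with trans (sym arcsᵢ) i∶uv
    ... | refl = mismatch-refl uv-mismatch
    not-joins arcsᵢ uv-mismatch vu-mismatch (inj₂ i∶vu) with trans (sym arcsᵢ) i∶vu
    ... | refl = mismatch-refl vu-mismatch
    find : ∀ {is b} i → FoundArc u v is b → FoundArc u v (is ∷ʳ i) (operator b i)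
    find {b = just j}  i found = found
    find {b = nothing} i none with arcs i in arcsᵢ
    ... | x , y with x ≟ᶠ u | y ≟ᶠ v | x ≟ᶠ v | y ≟ᶠ u
    ...   | yes refl | yes refl | _        | _        = inj₁ arcsᵢ
    ...   | yes refl | no  _    | yes refl | yes refl = inj₂ arcsᵢ
    ...   | yes refl | no  y≢v  | yes refl | no  y≢u  = ∷ʳ⁺ none (not-joins arcsᵢ (inj₂ y≢v) (inj₂ y≢u))
    ...   | yes refl | no  y≢v  | no  x≢v  | _        = ∷ʳ⁺ none (not-joins arcsᵢ (inj₂ y≢v) (inj₁ x≢v))
    ...   | no  _    | _        | yes refl | yes refl = inj₂ arcsᵢ
    ...   | no  x≢u  | _        | yes refl | no  y≢u  = ∷ʳ⁺ none (not-joins arcsᵢ (inj₁ x≢u) (inj₂ y≢u))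
    ...   | no  x≢u  | _        | no  x≢v  | _        = ∷ʳ⁺ none (not-joins arcsᵢ (inj₁ x≢u) (inj₁ x≢v))

  arcBetween-unique : NoParallelArcs arcs → ∀ {i u v} → Joins arcs i u v → arcBetween u v ≡ just i
  arcBetween-unique no-parallel {i} {u} {v} i∶uv with arcBetween u v | arcBetween-found u v
  ... | nothing | none    = ⊥-elim (All.lookup none (∈-arcList i) i∶uv)
  ... | just j  | j∶uv    = cong just (no-parallel j i u v j∶uv i∶uv)

  trace-parent : ∀ f {u v j} → v ≢ source → prev final v ≡ just u → arcBetween u v ≡ just j →
                 trace (suc f) v ≡ j ∷ trace f u
  trace-parent f {v = v} v≢src prev≡u arc≡j
    rewrite dec-false (v ≟ᶠ source) v≢src | prev≡u | arc≡j = refl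

  record Traced (f : ℕ) (v : Fin N) (d : ℕ) : Set where
    field
      start         : Fin N
      visited       : List (Fin N)
      walk          : Walk arcs start v visited (reverse (trace f v))
      visited-unique : Unique visited
      visited-within : All (λ x → dist final x ≤⁺ just d) visited
      weight≡       : dist final start +∞ weight (reverse (trace f v)) ≡ just d
      complete      : start ≡ source ⊎ length visited ≡ suc f

  traced-stop : ∀ {f v d} → trace f v ≡ [] → dist final v ≡ just d → v ≡ source ⊎ 1 ≡ suc f →
                Traced f v d
  traced-stop {f} {v} {d} trace≡[] dist≡d stop = record
    { start          = v
    ; visited        = v ∷ []
    ; walk           = subst (Walk arcs v v (v ∷ [])) (cong reverse (sym trace≡[])) here
    ; visited-unique = [] ∷ []
    ; visited-within = subst (_≤⁺ just d) (sym dist≡d) ≤⁺-refl ∷ []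
    ; weight≡        = begin
        dist final v +∞ weight (reverse (trace f v))
          ≡⟨ cong₂ (λ dv es → dv +∞ weight (reverse es)) dist≡d trace≡[] ⟩
        just (d + 0)
          ≡⟨ cong just (+-identityʳ d) ⟩
        just d
          ∎
    ; complete       = stop
    }
    where open ≡-Reasoning

  traced-step : ∀ {f u v j d du} → Joins arcs j u v → dist final v ≡ just d →
                dist final u ≡ just du → d ≡ du + W j →
                trace (suc f) v ≡ j ∷ trace f u → Traced f u du → Traced (suc f) v d
  traced-step {f} {u} {v} {j} {d} {du} j∶uv dist≡d dist≡du d≡ trace≡ T = record
    { start          = start
    ; visited        = visited ∷ʳ v
    ; walk           = subst (Walk arcs start v (visited ∷ʳ v)) (sym path≡) (walk-∷ʳ arcs j walk j∶uv)
    ; visited-unique = Unique.++⁺ visited-unique ([] ∷ []) v-unvisited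
    ; visited-within = ∷ʳ⁺ (All.map (λ x≤du → ≤⁺-trans ≤-trans x≤du [ <⇒≤ du<d ]) visited-within)
                           (subst (_≤⁺ just d) (sym dist≡d) ≤⁺-refl)
    ; weight≡        = weight≡′
    ; complete       = Data.Sum.map₂ longer complete
    }
    where
    open Traced T
    path≡ : reverse (trace (suc f) v) ≡ reverse (trace f u) ∷ʳ j
    path≡ = trans (cong reverse trace≡) (unfold-reverse j (trace f u))
    longer : length visited ≡ suc f → length (visited ∷ʳ v) ≡ suc (suc f)
    longer len≡ = trans (length-++ visited) (trans (cong (_+ 1) len≡) (+-comm (suc f) 1))
    du<d : du < d
    du<d = subst (du <_) (sym d≡) (m<m+n du (m^n>0 2 (toℕ j)))
    v-unvisited : ∀ {x} → ¬ (x ∈ visited × x ∈ v ∷ [])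
    v-unvisited (x∈ , here refl) with subst (_≤⁺ just du) dist≡d (All.lookup visited-within x∈)
    ... | [ d≤du ] = <⇒≱ du<d d≤du
    weight≡′ : dist final start +∞ weight (reverse (trace (suc f) v)) ≡ just d
    weight≡′ = begin
      dist final start +∞ weight (reverse (trace (suc f) v))
        ≡⟨ cong (λ es → dist final start +∞ weight es) path≡ ⟩
      dist final start +∞ weight (reverse (trace f u) ∷ʳ j)
        ≡⟨ cong (dist final start +∞_) (weight-∷ʳ (reverse (trace f u)) j) ⟩
      dist final start +∞ (weight (reverse (trace f u)) + W j) ≡⟨ +∞-assoc _ _ (W j) ⟨
      dist final start +∞ weight (reverse (trace f u)) +∞ W j ≡⟨ cong (_+∞ W j) weight≡ ⟩
      just (du + W j)                                         ≡⟨ cong just d≡ ⟨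
      just d                                                  ∎
      where open ≡-Reasoning

  traced : NoParallelArcs arcs → ∀ f {v d} → dist final v ≡ just d → Traced f v d
  traced _ zero dist≡d = traced-stop refl dist≡d (inj₂ refl)
  traced no-parallel (suc f) {v} {d} dist≡d with v ≟ᶠ source
  ... | yes refl  = traced-stop refl dist≡d (inj₁ refl)
  ... | no v≢src with parents v≢src dist≡d
  ...   | parent u j du prev≡u _ j∶uv dist≡du d≡ =
          traced-step j∶uv dist≡d dist≡du d≡
            (trace-parent f v≢src prev≡u (arcBetween-unique no-parallel j∶uv))
            (traced no-parallel f dist≡du)

  output-lightest : NoParallelArcs arcs → Connected arcs →
                    SimplePath arcs source sink outputArcs ×
                    (∀ {ns es} → Walk arcs source sink ns es → weight outputArcs ≤ weight es)
  -- Connectivity makes the sink's distance finite, and a trace of N + 1 distinct nodes is impossible.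
  output-lightest no-parallel connected with connected source sink
  ... | _ , _ , some-walk with dist final sink in dist≡ | dist-sink≤weight some-walk
  ...   | nothing | ()
  ...   | just D  | _ with traced no-parallel N {sink} {D} dist≡
  ...     | T with Traced.complete T
  ...       | inj₂ too-long = ⊥-elim (<⇒≱ (s≤s ≤-refl) (subst (_≤ N) too-long (Unique⇒length≤ visited-unique)))
    where open Traced T
  ...       | inj₁ start≡source = (visited , walk′ , visited-unique) , lightest
    where
    open Traced T
    walk′ : Walk arcs source sink visited outputArcs
    walk′ = subst (λ a → Walk arcs a sink visited outputArcs) start≡source walk
    weight≡D : weight outputArcs ≡ D
    weight≡D = just-injective (begin
      just (weight outputArcs)               ≡⟨ cong (_+∞ weight outputArcs) source-dist ⟨
      dist final source +∞ weight outputArcs ≡⟨ cong (λ a → dist final a +∞ weight outputArcs) start≡source ⟨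
      dist final start +∞ weight outputArcs  ≡⟨ weight≡ ⟩
      just D                                 ∎)
      where open ≡-Reasoning
    lightest : ∀ {ns es} → Walk arcs source sink ns es → weight outputArcs ≤ weight es
    lightest w with subst (_≤⁺ just _) dist≡ (dist-sink≤weight w)
    ... | [ D≤ ] = subst (_≤ _) (sym weight≡D) D≤

theorem2 : (k m : ℕ) (arcs : Arcs (suc k) m) →
    NoSelfLoops arcs → NoParallelArcs arcs → Connected arcs →
    SimplePath arcs (EPA.source arcs) (EPA.sink arcs) (EPA.outputArcs arcs)
    × ¬ (∃[ es ] (SimplePath arcs (EPA.source arcs) (EPA.sink arcs) es
    × (incidence es ≪ EPA.outputP arcs)))
theorem2 k m arcs _ no-parallel connected = output-path , no-earlier
  where
  open Dijkstra k m arcs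
  open EPA arcs
  output-path : SimplePath arcs source sink outputArcs
  output-path = proj₁ (output-lightest no-parallel connected)
  lightest : ∀ {ns es} → Walk arcs source sink ns es → weight outputArcs ≤ weight es
  lightest = proj₂ (output-lightest no-parallel connected)
  no-earlier : ¬ (∃[ es ] (SimplePath arcs source sink es × (incidence es ≪ outputP)))
  no-earlier (es , (ns , w , ns-unique) , es≪P) with output-path
  ... | nsP , wP , nsP-unique =
    <⇒≱ (subst₂ _<_ (value-incidence (simple-walk-arcs-unique arcs w ns-unique))
                     (value-incidence (simple-walk-arcs-unique arcs wP nsP-unique))
                     (≪⇒value< es≪P))
         (lightest w)
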